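{- For every positive integer $n$ with $n\equiv 1\pmod 4$, $$t(2,2,3,9;n)=\frac43\,N(2,2,3,9;\,2n+4).$$
   Context: For positive integers $a,b,c,d$ and an integer $n\ge 0$, $N(a,b,c,d;n)$ denotes the number of $(x,y,z,w)\in\mathbb Z^4$ with $n=ax^2+by^2+cz^2+dw^2$, and $t(a,b,c,d;n)$ denotes the number of $(x,y,z,w)\in\mathbb Z^4$ with $n=a\frac{x(x-1)}2+b\frac{y(y-1)}2+c\frac{z(z-1)}2+d\frac{w(w-1)}2$. -}

module Defs where

open import Data.Nat using (ℕ; _+_; _*_; _^_; _/_; _≟_)
open import Data.Integer as ℤ using (ℤ; +_; ∣_∣)
open import Data.List using (List; map; upTo; length; filter; concatMap)
open import Data.Product using (_×_; _,_)

range : ℕ → List ℤ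
range B = map (λ i → (+ i) ℤ.- (+ B)) (upTo (2 * B + 1))

box4 : ℕ → List (ℤ × ℤ × ℤ × ℤ)
box4 B = concatMap (λ x → concatMap (λ y → concatMap (λ z → map (λ w → (x , y , z , w))
           (range B)) (range B)) (range B)) (range B)

sq : ℤ → ℕ
sq x = ∣ x ∣ ^ 2

-- x(x-1)/2 (as a natural number; x(x-1) ≥ 0 and is even)
tri : ℤ → ℕ
tri x = ∣ x ℤ.* (x ℤ.- + 1) ∣ / 2

count4 : ℕ → (ℤ → ℕ) → ℕ → ℕ → ℕ → ℕ → ℕ → ℕ
count4 B f a b c d n =
  length (filter (λ { (x , y , z , w) → (a * f x + b * f y + c * f z + d * f w) ≟ n }) (box4 B))

-- N(a,b,c,d;n) = #{(x,y,z,w) ∈ ℤ^4 : n = ax²+by²+cz²+dw²}.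
-- For positive a,b,c,d every solution has |x|,|y|,|z|,|w| ≤ n, so the box [-(n+1), n+1]^4 contains all solutions.
N : ℕ → ℕ → ℕ → ℕ → ℕ → ℕ
N a b c d n = count4 (n + 1) sq a b c d n

-- For positive a,b,c,d every solution has -n ≤ x ≤ n+1 (same for y,z,w), so the box [-(n+1), n+1]^4 contains all solutions.
t : ℕ → ℕ → ℕ → ℕ → ℕ → ℕ
t a b c d n = count4 (n + 1) tri a b c d n

module Submission where

-- For n ≡ 1 (mod 4) put m = 2n + 4 ≡ 6 (mod 8).  The substitution x ↦ 2x − 1 turns x(x − 1)/2
-- into ((2x − 1)² − 1)/8, so t(2,2,3,9;n) counts the solutions of 2a² + 2b² + 3c² + 9d² = 4m in odd
-- integers.  Modulo 8, every solution of 2a² + 2b² + 3c² + 9d² = m has c, d both odd, or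
-- (c, d) = 2(p, q) with p + q odd.  Multiplying c + d√−3 by a primitive cube root of unity (which
-- stays integral when c ≡ d mod 2) preserves c² + 3d², and shows that, whatever condition is imposed
-- on a, b and c² + 3d², pairs (c, d) of the first kind are exactly twice as many as pairs of the
-- second kind.  Alternating this with the substitution (a, b) ↦ (a + b, a − b) and with regroupings
-- of the four squares expresses both counts through
-- X = #{2a² + 2b² + 3c² + 9d² = m, (c, d) = 2(p, q), p + q odd}: N(2,2,3,9;m) = 3X, t(2,2,3,9;n) = 4X.

open import Defs

module _ where

  open import Data.Nat as ℕ using (ℕ; zero; suc; z≤n; s≤s; NonZero)
  import Data.Nat.Properties as ℕₚ
  open import Data.Nat.DivMod using (m*n/n≡m)
  import Data.Nat.Tactic.RingSolver as ℕ-Solver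
  open import Data.Integer as ℤ using (ℤ; +_; -[1+_]; ∣_∣; _+_; _*_; _-_; -_)
  import Data.Integer.Properties as ℤₚ
  open import Data.Integer.DivMod using (_/ℕ_; _%ℕ_; n%ℕd<d; a≡a%ℕn+[a/ℕn]*n)
  open import Data.Integer.Tactic.RingSolver using (solve; solve-∀)
  open import Algebra.Properties.AbelianGroup ℤₚ.+-0-abelianGroup using ()
    renaming (∙-cancelˡ to +-cancelˡ; ∙-cancelʳ to +-cancelʳ)
  open import Data.List using (List; []; _∷_; _++_; length; filter; map; concatMap; cartesianProduct)
  open import Data.List.Properties using (length-map; map-id; map-++; map-∘; concatMap-cong; filter-≐)
  open import Data.List.Membership.Propositional using (_∈_)
  open import Data.List.Membership.Propositional.Properties
    using (∈-map⁺; ∈-map⁻; ∈-filter⁺; ∈-filter⁻; ∈-upTo⁺; ∈-cartesianProduct⁺)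
  open import Data.List.Membership.Propositional.Properties.WithK using (unique∧set⇒bag)
  open import Data.List.Relation.Unary.All as All using (All)
  import Data.List.Relation.Unary.All.Properties as Allₚ
  import Data.List.Relation.Unary.AllPairs as AllPairs
  open import Data.List.Relation.Unary.Unique.Propositional using (Unique)
  import Data.List.Relation.Unary.Unique.Propositional.Properties as Uniqueₚ
  open import Data.List.Relation.Binary.BagAndSetEquality using (∼bag⇒↭)
  open import Data.List.Relation.Binary.Permutation.Propositional.Properties using (↭-length)
  open import Data.Product using (_×_; _,_; proj₁; proj₂; ∃-syntax; ∃₂)
  open import Data.Sum as Sum using (_⊎_; inj₁; inj₂)
  open import Data.Empty using (⊥-elim)
  open import Function using (_∘_; id)
  open import Function.Bundles using (mk⇔)
  open import Level using (0ℓ)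
  open import Relation.Nullary using (¬_; Dec; yes; no; _×-dec_)
  open import Relation.Unary using (Pred; Decidable; _⊆_; U; _⟨×⟩_; _∩_)
  open import Relation.Unary.Properties using (U?; _×?_; _∩?_)
  open import Relation.Binary.PropositionalEquality
  open ≡-Reasoning

  -- Parity

  Even Odd : Pred ℤ 0ℓ
  Even x = ∃[ h ] x ≡ + 2 * h
  Odd  x = ∃[ h ] x ≡ + 1 + + 2 * h

  private
    twice≢1 : ∀ x → x * + 2 ≢ + 1
    twice≢1 (+ zero)  ()
    twice≢1 (+ suc n) ()
    twice≢1 -[1+ n ]  ()

  even≢odd : ∀ h k → + 2 * h ≢ + 1 + + 2 * k
  even≢odd h k eq = twice≢1 (h - k) (begin
    (h - k) * + 2            ≡⟨ solve (h ∷ k ∷ []) ⟩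
    + 2 * h - + 2 * k        ≡⟨ cong (_- + 2 * k) eq ⟩
    + 1 + + 2 * k - + 2 * k  ≡⟨ solve (k ∷ []) ⟩
    + 1                      ∎)

  even⇒¬odd : ∀ {x} → Even x → ¬ Odd x
  even⇒¬odd (h , refl) (k , eq) = even≢odd h k eq

  even-or-odd : ∀ x → Even x ⊎ Odd x
  even-or-odd x with x /ℕ 2 | x %ℕ 2 | n%ℕd<d x 2 | a≡a%ℕn+[a/ℕn]*n x 2
  ... | q | 0           | _            | eq = inj₁ (q , (begin x ≡⟨ eq ⟩ + 0 + q * + 2 ≡⟨ solve (q ∷ []) ⟩ + 2 * q ∎))
  ... | q | 1           | _            | eq = inj₂ (q , (begin x ≡⟨ eq ⟩ + 1 + q * + 2 ≡⟨ solve (q ∷ []) ⟩ + 1 + + 2 * q ∎))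
  ... | _ | suc (suc _) | s≤s (s≤s ()) | _

  odd? : Decidable Odd
  odd? x with even-or-odd x
  ... | inj₁ x-even = no (even⇒¬odd x-even)
  ... | inj₂ x-odd  = yes x-odd

  even? : Decidable Even
  even? x with even-or-odd x
  ... | inj₁ x-even = yes x-even
  ... | inj₂ x-odd  = no (λ x-even → even⇒¬odd x-even x-odd)

  twice-even : ∀ x → Even (+ 2 * x)
  twice-even x = x , refl

  +-even-even : ∀ {x y} → Even x → Even y → Even (x + y)
  +-even-even (h , refl) (k , refl) = h + k , sym (ℤₚ.*-distribˡ-+ (+ 2) h k)

  +-odd-even : ∀ {x y} → Odd x → Even y → Odd (x + y)
  +-odd-even (h , refl) (k , refl) = h + k , lemma h k
    where
    lemma : ∀ h k → + 1 + + 2 * h + + 2 * k ≡ + 1 + + 2 * (h + k)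
    lemma = solve-∀

  +-even-odd : ∀ {x y} → Even x → Odd y → Odd (x + y)
  +-even-odd {x} {y} x-even y-odd = subst Odd (ℤₚ.+-comm y x) (+-odd-even y-odd x-even)

  +-odd-odd : ∀ {x y} → Odd x → Odd y → Even (x + y)
  +-odd-odd (h , refl) (k , refl) = + 1 + h + k , lemma h k
    where
    lemma : ∀ h k → + 1 + + 2 * h + (+ 1 + + 2 * k) ≡ + 2 * (+ 1 + h + k)
    lemma = solve-∀

  neg-even : ∀ {x} → Even x → Even (- x)
  neg-even (h , refl) = - h , lemma h
    where
    lemma : ∀ h → - (+ 2 * h) ≡ + 2 * (- h)
    lemma = solve-∀

  neg-odd : ∀ {x} → Odd x → Odd (- x)
  neg-odd (h , refl) = - + 1 - h , lemma h
    where
    lemma : ∀ h → - (+ 1 + + 2 * h) ≡ + 1 + + 2 * (- + 1 - h)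
    lemma = solve-∀

  odd-sum⇒odd-diff : ∀ a b → Odd (a + b) → Odd (a - b)
  odd-sum⇒odd-diff a b a+b-odd = subst Odd (lemma a b) (+-odd-even a+b-odd (neg-even (twice-even b)))
    where
    lemma : ∀ a b → a + b + - (+ 2 * b) ≡ a - b
    lemma = solve-∀

  private
    a+b-a≡b : ∀ a b → a + b + - a ≡ b
    a+b-a≡b = solve-∀

  odd-sum∧odd⇒even : ∀ a b → Odd (a + b) → Odd a → Even b
  odd-sum∧odd⇒even a b a+b-odd a-odd = subst Even (a+b-a≡b a b) (+-odd-odd a+b-odd (neg-odd a-odd))

  odd-sum∧even⇒odd : ∀ a b → Odd (a + b) → Even a → Odd b
  odd-sum∧even⇒odd a b a+b-odd a-even = subst Odd (a+b-a≡b a b) (+-odd-even a+b-odd (neg-even a-even))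

  odd-square : ∀ {x} → Odd x → ∃[ t ] x * x ≡ + 1 + + 8 * t
  odd-square (h , refl) with even-or-odd h
  ... | inj₁ (r , refl) = r + + 2 * (r * r) , (begin
    (+ 1 + + 2 * (+ 2 * r)) * (+ 1 + + 2 * (+ 2 * r))              ≡⟨ solve (r ∷ []) ⟩
    + 1 + + 8 * (r + + 2 * (r * r))                                ∎)
  ... | inj₂ (r , refl) = + 1 + + 3 * r + + 2 * (r * r) , (begin
    (+ 1 + + 2 * (+ 1 + + 2 * r)) * (+ 1 + + 2 * (+ 1 + + 2 * r))  ≡⟨ solve (r ∷ []) ⟩
    + 1 + + 8 * (+ 1 + + 3 * r + + 2 * (r * r))                    ∎)

  r+m*2h≢r+m*[1+2k] : ∀ m .{{_ : NonZero m}} r h k → r + + m * (+ 2 * h) ≢ r + + m * (+ 1 + + 2 * k)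
  r+m*2h≢r+m*[1+2k] m r h k = even≢odd h k ∘ ℤₚ.*-cancelˡ-≡ (+ m) _ _ ∘ +-cancelˡ r _ _

  sum-of-two-squares≢3-mod-4 : ∀ a b j → a * a + b * b ≢ + 3 + + 4 * j
  sum-of-two-squares≢3-mod-4 a b j eq with even-or-odd a | even-or-odd b
  ... | inj₁ (i , refl) | inj₁ (k , refl) = even≢odd (+ 2 * (i * i + k * k)) (+ 1 + + 2 * j) (begin
    + 2 * (+ 2 * (i * i + k * k))                                        ≡⟨ solve (i ∷ k ∷ []) ⟩
    (+ 2 * i) * (+ 2 * i) + (+ 2 * k) * (+ 2 * k)                        ≡⟨ eq ⟩
    + 3 + + 4 * j                                                        ≡⟨ solve (j ∷ []) ⟩
    + 1 + + 2 * (+ 1 + + 2 * j)                                          ∎)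
  ... | inj₂ (i , refl) | inj₂ (k , refl) = even≢odd (+ 1 + + 2 * (i + i * i + k + k * k)) (+ 1 + + 2 * j) (begin
    + 2 * (+ 1 + + 2 * (i + i * i + k + k * k))                          ≡⟨ solve (i ∷ k ∷ []) ⟩
    (+ 1 + + 2 * i) * (+ 1 + + 2 * i) + (+ 1 + + 2 * k) * (+ 1 + + 2 * k) ≡⟨ eq ⟩
    + 3 + + 4 * j                                                        ≡⟨ solve (j ∷ []) ⟩
    + 1 + + 2 * (+ 1 + + 2 * j)                                          ∎)
  ... | inj₂ (i , refl) | inj₁ (k , refl) = r+m*2h≢r+m*[1+2k] 2 (+ 1) (i + i * i + k * k) j (begin
    + 1 + + 2 * (+ 2 * (i + i * i + k * k))                              ≡⟨ solve (i ∷ k ∷ []) ⟩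
    (+ 1 + + 2 * i) * (+ 1 + + 2 * i) + (+ 2 * k) * (+ 2 * k)            ≡⟨ eq ⟩
    + 3 + + 4 * j                                                        ≡⟨ solve (j ∷ []) ⟩
    + 1 + + 2 * (+ 1 + + 2 * j)                                          ∎)
  ... | inj₁ (i , refl) | inj₂ (k , refl) = r+m*2h≢r+m*[1+2k] 2 (+ 1) (i * i + k + k * k) j (begin
    + 1 + + 2 * (+ 2 * (i * i + k + k * k))                              ≡⟨ solve (i ∷ k ∷ []) ⟩
    (+ 2 * i) * (+ 2 * i) + (+ 1 + + 2 * k) * (+ 1 + + 2 * k)            ≡⟨ eq ⟩
    + 3 + + 4 * j                                                        ≡⟨ solve (j ∷ []) ⟩
    + 1 + + 2 * (+ 1 + + 2 * j)                                          ∎)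

  -- Counting lattice points in a box

  infix 4 _⇿_

  record _⇿_ {A B : Set} (P : Pred A 0ℓ) (Q : Pred B 0ℓ) : Set where
    field
      to         : A → B
      to-∈       : P ⊆ Q ∘ to
      injective  : ∀ {x y} → P x → P y → to x ≡ to y → x ≡ y
      surjective : ∀ {y} → Q y → ∃[ x ] P x × to x ≡ y

  inverses⇒⇿ : {A B : Set} {P : Pred A 0ℓ} {Q : Pred B 0ℓ} (f : A → B) (g : B → A) →
               P ⊆ Q ∘ f → Q ⊆ P ∘ g → (∀ x → g (f x) ≡ x) → (∀ y → f (g y) ≡ y) → P ⇿ Q
  inverses⇒⇿ f g P⊆Q∘f Q⊆P∘g g∘f≗id f∘g≗id = record
    { to         = f
    ; to-∈       = P⊆Q∘f
    ; injective  = λ {x} {y} _ _ fx≡fy → trans (sym (g∘f≗id x)) (trans (cong g fx≡fy) (g∘f≗id y))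
    ; surjective = λ {y} qy → g y , Q⊆P∘g qy , f∘g≗id y
    }

  module _ {A B : Set} {P : Pred A 0ℓ} {Q : Pred B 0ℓ} (P? : Decidable P) (Q? : Decidable Q) where

    private
      map-injectiveOn⁺ : (f : A → B) → (∀ {x y} → P x → P y → f x ≡ f y → x ≡ y) →
                         ∀ {xs} → All P xs → Unique xs → Unique (map f xs)
      map-injectiveOn⁺ f inj All.[]         AllPairs.[]         = AllPairs.[]
      map-injectiveOn⁺ f inj (px All.∷ pxs) (x∉ AllPairs.∷ uxs) =
        Allₚ.map⁺ (All.zipWith (λ (py , x≢y) → x≢y ∘ inj px py) (pxs , x∉)) AllPairs.∷ map-injectiveOn⁺ f inj pxs uxs

    length-filter-⇿ : ∀ {xs ys} → Unique xs → Unique ys → P ⊆ (_∈ xs) → Q ⊆ (_∈ ys) →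
                      P ⇿ Q → length (filter P? xs) ≡ length (filter Q? ys)
    length-filter-⇿ {xs} {ys} uxs uys P⊆xs Q⊆ys P⇿Q = begin
      length (filter P? xs)          ≡⟨ length-map to (filter P? xs) ⟨
      length (map to (filter P? xs)) ≡⟨ ↭-length (∼bag⇒↭ (unique∧set⇒bag unique (Uniqueₚ.filter⁺ Q? uys) (mk⇔ forth back))) ⟩
      length (filter Q? ys)          ∎
      where
      open _⇿_ P⇿Q
      unique : Unique (map to (filter P? xs))
      unique = map-injectiveOn⁺ to injective (Allₚ.all-filter P? xs) (Uniqueₚ.filter⁺ P? uxs)
      forth : ∀ {y} → y ∈ map to (filter P? xs) → y ∈ filter Q? ys
      forth y∈ with x , x∈ , refl ← ∈-map⁻ to y∈ =
        let qy = to-∈ (proj₂ (∈-filter⁻ P? {xs = xs} x∈)) in ∈-filter⁺ Q? (Q⊆ys qy) qy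
      back : ∀ {y} → y ∈ filter Q? ys → y ∈ map to (filter P? xs)
      back y∈ with x , px , refl ← surjective (proj₂ (∈-filter⁻ Q? {xs = ys} y∈)) =
        ∈-map⁺ to (∈-filter⁺ P? (P⊆xs px) px)

  module _ {A : Set} {P Q R : Pred A 0ℓ} (P? : Decidable P) (Q? : Decidable Q) (R? : Decidable R)
           (P⊆Q∪R : ∀ {x} → P x → Q x ⊎ R x) (Q⊆P : Q ⊆ P) (R⊆P : R ⊆ P) (Q∩R=∅ : ∀ {x} → Q x → ¬ R x) where

    length-filter-⊎ : ∀ xs → length (filter P? xs) ≡ length (filter Q? xs) ℕ.+ length (filter R? xs)
    length-filter-⊎ []       = refl
    length-filter-⊎ (x ∷ xs) with P? x | Q? x | R? x
    ... | _      | yes qx | yes rx = ⊥-elim (Q∩R=∅ qx rx)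
    ... | yes _  | yes _  | no _   = cong suc (length-filter-⊎ xs)
    ... | yes _  | no _   | yes _  = trans (cong suc (length-filter-⊎ xs)) (sym (ℕₚ.+-suc _ _))
    ... | yes px | no ¬qx | no ¬rx = Sum.[ ⊥-elim ∘ ¬qx , ⊥-elim ∘ ¬rx ] (P⊆Q∪R px)
    ... | no ¬px | yes qx | no _   = ⊥-elim (¬px (Q⊆P qx))
    ... | no ¬px | no _   | yes rx = ⊥-elim (¬px (R⊆P rx))
    ... | no _   | no _   | no _   = length-filter-⊎ xs

  Z4 : Set
  Z4 = ℤ × ℤ × ℤ × ℤ

  Z4-≡ : ∀ {a a′ b b′ c c′ d d′ : ℤ} → a ≡ a′ → b ≡ b′ → c ≡ c′ → d ≡ d′ →
         (a , b , c , d) ≡ (a′ , b′ , c′ , d′)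
  Z4-≡ refl refl refl refl = refl

  InBox : ℕ → Pred Z4 0ℓ
  InBox B (a , b , c , d) = ∣ a ∣ ℕ.≤ B × ∣ b ∣ ℕ.≤ B × ∣ c ∣ ℕ.≤ B × ∣ d ∣ ℕ.≤ B

  InBox-mono : ∀ {K B} → K ℕ.≤ B → ∀ z → InBox K z → InBox B z
  InBox-mono K≤B (a , b , c , d) (a≤ , b≤ , c≤ , d≤) =
    ℕₚ.≤-trans a≤ K≤B , ℕₚ.≤-trans b≤ K≤B , ℕₚ.≤-trans c≤ K≤B , ℕₚ.≤-trans d≤ K≤B

  private
    x+y-y≡x : ∀ x y → x + y - y ≡ x
    x+y-y≡x = solve-∀

    x-y+y≡x : ∀ x y → x - y + y ≡ x
    x-y+y≡x = solve-∀

  range-unique : ∀ B → Unique (range B)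
  range-unique B = Uniqueₚ.map⁺ shift-injective (Uniqueₚ.upTo⁺ (2 ℕ.* B ℕ.+ 1))
    where
    shift-injective : ∀ {i j} → + i - + B ≡ + j - + B → i ≡ j
    shift-injective {i} {j} eq = ℤₚ.+-injective (begin
      + i              ≡⟨ x-y+y≡x (+ i) (+ B) ⟨
      + i - + B + + B  ≡⟨ cong (_+ + B) eq ⟩
      + j - + B + + B  ≡⟨ x-y+y≡x (+ j) (+ B) ⟩
      + j              ∎)

  ∈-range : ∀ {B x} → ∣ x ∣ ℕ.≤ B → x ∈ range B
  ∈-range {B} {x} ∣x∣≤B with offset x ∣x∣≤B
    where
    offset : ∀ x → ∣ x ∣ ℕ.≤ B → ∃[ i ] i ℕ.≤ 2 ℕ.* B × + i ≡ x + + B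
    offset (+ k)    k≤B  = k ℕ.+ B , ℕₚ.+-mono-≤ k≤B (ℕₚ.m≤m+n B 0) , ℤₚ.pos-+ k B
    offset -[1+ k ] k<B  = B ℕ.∸ suc k , ℕₚ.≤-trans (ℕₚ.m∸n≤m B (suc k)) (ℕₚ.m≤m+n B (B ℕ.+ 0)) , sym (ℤₚ.⊖-≥ k<B)
  ... | i , i≤2B , +i≡x+B =
    subst (_∈ range B) (trans (cong (_- + B) +i≡x+B) (x+y-y≡x x (+ B)))
          (∈-map⁺ (λ i → + i - + B) (∈-upTo⁺ (ℕₚ.≤-<-trans i≤2B (ℕₚ.m<m+n (2 ℕ.* B) (s≤s z≤n)))))

  concatMap-map-pairs : {A B C : Set} (g : A × B → C) (xs : List A) (ys : List B) →
                        concatMap (λ x → map (λ y → g (x , y)) ys) xs ≡ map g (cartesianProduct xs ys)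
  concatMap-map-pairs g []       ys = refl
  concatMap-map-pairs g (x ∷ xs) ys =
    trans (cong₂ _++_ (map-∘ {g = g} {f = x ,_} ys) (concatMap-map-pairs g xs ys))
          (sym (map-++ g (map (x ,_) ys) (cartesianProduct xs ys)))

  box4-cartesian : ∀ B → let R = range B in box4 B ≡ cartesianProduct R (cartesianProduct R (cartesianProduct R R))
  box4-cartesian B = begin
    box4 B                             ≡⟨ concatMap-cong rows R ⟩
    concatMap (λ a → map (a ,_) R₃) R  ≡⟨ concatMap-map-pairs id R R₃ ⟩
    map id (cartesianProduct R R₃)     ≡⟨ map-id _ ⟩
    cartesianProduct R R₃              ∎
    where
    R  = range B
    R₂ = cartesianProduct R R
    R₃ = cartesianProduct R R₂
    rows : ∀ a → concatMap (λ b → concatMap (λ c → map (λ d → a , b , c , d) R) R) R ≡ map (a ,_) R₃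
    rows a = trans (concatMap-cong (λ b → concatMap-map-pairs (λ cd → a , b , cd) R R) R)
                   (concatMap-map-pairs (a ,_) R R₂)

  box4-unique : ∀ B → Unique (box4 B)
  box4-unique B rewrite box4-cartesian B =
    Uniqueₚ.cartesianProduct⁺ uR (Uniqueₚ.cartesianProduct⁺ uR (Uniqueₚ.cartesianProduct⁺ uR uR))
    where uR = range-unique B

  ∈-box4 : ∀ {B} z → InBox B z → z ∈ box4 B
  ∈-box4 {B} (a , b , c , d) (a≤ , b≤ , c≤ , d≤) rewrite box4-cartesian B =
    ∈-cartesianProduct⁺ (∈-range a≤) (∈-cartesianProduct⁺ (∈-range b≤) (∈-cartesianProduct⁺ (∈-range c≤) (∈-range d≤)))

  count : ℕ → {P : Pred Z4 0ℓ} → Decidable P → ℕ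
  count B P? = length (filter P? (box4 B))

  Bounded : ℕ → Pred Z4 0ℓ → Set
  Bounded B P = ∀ z → P z → InBox B z

  count-⇿ : ∀ {B₁ B₂} {P Q : Pred Z4 0ℓ} (P? : Decidable P) (Q? : Decidable Q) →
            Bounded B₁ P → Bounded B₂ Q → P ⇿ Q → count B₁ P? ≡ count B₂ Q?
  count-⇿ {B₁} {B₂} P? Q? P-bounded Q-bounded = length-filter-⇿ P? Q? (box4-unique B₁) (box4-unique B₂)
    (λ {z} → ∈-box4 z ∘ P-bounded z) (λ {z} → ∈-box4 z ∘ Q-bounded z)

  count-⊎ : ∀ B {P Q R : Pred Z4 0ℓ} (P? : Decidable P) (Q? : Decidable Q) (R? : Decidable R) →
            (∀ z → P z → Q z ⊎ R z) → (∀ z → Q z → P z) → (∀ z → R z → P z) → (∀ z → Q z → ¬ R z) →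
            count B P? ≡ count B Q? ℕ.+ count B R?
  count-⊎ B P? Q? R? P⊆Q∪R Q⊆P R⊆P Q∩R=∅ =
    length-filter-⊎ P? Q? R? (P⊆Q∪R _) (Q⊆P _) (R⊆P _) (Q∩R=∅ _) (box4 B)

  count-≐ : ∀ B {P Q : Pred Z4 0ℓ} (P? : Decidable P) (Q? : Decidable Q) → P ⊆ Q → Q ⊆ P → count B P? ≡ count B Q?
  count-≐ B P? Q? P⊆Q Q⊆P = cong length (filter-≐ P? Q? (P⊆Q , Q⊆P) (box4 B))

  -- Diagonal quadratic forms

  -- The INLINE pragmas here and below let the ring solver see through these definitions.
  norm₃ : ℤ → ℤ → ℤ
  norm₃ c d = c * c + + 3 * (d * d)
  {-# INLINE norm₃ #-}

  form : ℕ → ℕ → ℕ → ℤ → ℤ → ℤ → ℤ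
  form α β γ a b s = + α * (a * a) + + β * (b * b) + + γ * s
  {-# INLINE form #-}

  square-abs : ∀ x → x * x ≡ + (∣ x ∣ ℕ.* ∣ x ∣)
  square-abs (+ zero)  = refl
  square-abs (+ suc n) = refl
  square-abs -[1+ n ]  = refl

  pos-diagonal : ∀ α β γ δ p q r s →
    + (α ℕ.* p ℕ.+ β ℕ.* q ℕ.+ γ ℕ.* r ℕ.+ δ ℕ.* s) ≡ + α * + p + + β * + q + + γ * + r + + δ * + s
  pos-diagonal α β γ δ p q r s =
    trans (ℤₚ.pos-+ _ (δ ℕ.* s)) (cong₂ _+_
      (trans (ℤₚ.pos-+ _ (γ ℕ.* r)) (cong₂ _+_
        (trans (ℤₚ.pos-+ (α ℕ.* p) (β ℕ.* q)) (cong₂ _+_ (ℤₚ.pos-* α p) (ℤₚ.pos-* β q)))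
        (ℤₚ.pos-* γ r)))
      (ℤₚ.pos-* δ s))

  diagonal-terms-bounded : ∀ α β γ δ .{{_ : NonZero α}} .{{_ : NonZero β}} .{{_ : NonZero γ}} .{{_ : NonZero δ}}
    {p q r s K} → α ℕ.* p ℕ.+ β ℕ.* q ℕ.+ γ ℕ.* r ℕ.+ δ ℕ.* s ≡ K → p ℕ.≤ K × q ℕ.≤ K × r ℕ.≤ K × s ℕ.≤ K
  diagonal-terms-bounded α β γ δ {p} {q} {r} {s} refl =
    term≤ α (ℕₚ.≤-trans (ℕₚ.m≤m+n t₁ t₂) (ℕₚ.≤-trans (ℕₚ.m≤m+n _ t₃) (ℕₚ.m≤m+n _ t₄))) ,
    term≤ β (ℕₚ.≤-trans (ℕₚ.m≤n+m t₂ t₁) (ℕₚ.≤-trans (ℕₚ.m≤m+n _ t₃) (ℕₚ.m≤m+n _ t₄))) ,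
    term≤ γ (ℕₚ.≤-trans (ℕₚ.m≤n+m t₃ (t₁ ℕ.+ t₂)) (ℕₚ.m≤m+n _ t₄)) ,
    term≤ δ (ℕₚ.m≤n+m t₄ (t₁ ℕ.+ t₂ ℕ.+ t₃))
    where
    t₁ = α ℕ.* p
    t₂ = β ℕ.* q
    t₃ = γ ℕ.* r
    t₄ = δ ℕ.* s
    term≤ : ∀ k .{{_ : NonZero k}} {x S} → k ℕ.* x ℕ.≤ S → x ℕ.≤ S
    term≤ k {x} = ℕₚ.≤-trans (ℕₚ.m≤n*m x k)

  form-abs : ∀ α β γ a b c d → form α β γ a b (norm₃ c d) ≡
    + (α ℕ.* (∣ a ∣ ℕ.* ∣ a ∣) ℕ.+ β ℕ.* (∣ b ∣ ℕ.* ∣ b ∣) ℕ.+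
       γ ℕ.* (∣ c ∣ ℕ.* ∣ c ∣) ℕ.+ 3 ℕ.* γ ℕ.* (∣ d ∣ ℕ.* ∣ d ∣))
  form-abs α β γ a b c d = begin
    form α β γ a b (norm₃ c d)
      ≡⟨ regroup (+ α) (+ β) (+ γ) a b c d ⟩
    + α * (a * a) + + β * (b * b) + + γ * (c * c) + + 3 * + γ * (d * d)
      ≡⟨ cong (λ { (p , q , r , s) → + α * p + + β * q + + γ * r + + 3 * + γ * s })
              (Z4-≡ (square-abs a) (square-abs b) (square-abs c) (square-abs d)) ⟩
    + α * + ∣a∣² + + β * + ∣b∣² + + γ * + ∣c∣² + + 3 * + γ * + ∣d∣²
      ≡⟨ cong (λ k → + α * + ∣a∣² + + β * + ∣b∣² + + γ * + ∣c∣² + k * + ∣d∣²) (ℤₚ.pos-* 3 γ) ⟨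
    + α * + ∣a∣² + + β * + ∣b∣² + + γ * + ∣c∣² + + (3 ℕ.* γ) * + ∣d∣²
      ≡⟨ pos-diagonal α β γ (3 ℕ.* γ) ∣a∣² ∣b∣² ∣c∣² ∣d∣² ⟨
    + (α ℕ.* ∣a∣² ℕ.+ β ℕ.* ∣b∣² ℕ.+ γ ℕ.* ∣c∣² ℕ.+ 3 ℕ.* γ ℕ.* ∣d∣²) ∎
    where
    ∣a∣² = ∣ a ∣ ℕ.* ∣ a ∣
    ∣b∣² = ∣ b ∣ ℕ.* ∣ b ∣
    ∣c∣² = ∣ c ∣ ℕ.* ∣ c ∣
    ∣d∣² = ∣ d ∣ ℕ.* ∣ d ∣
    regroup : ∀ α β γ a b c d → α * (a * a) + β * (b * b) + γ * (c * c + + 3 * (d * d)) ≡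
                                α * (a * a) + β * (b * b) + γ * (c * c) + + 3 * γ * (d * d)
    regroup = solve-∀

  form-bounded : ∀ α β γ .{{_ : NonZero α}} .{{_ : NonZero β}} .{{_ : NonZero γ}} {K} a b c d →
                 form α β γ a b (norm₃ c d) ≡ + K → InBox K (a , b , c , d)
  form-bounded α β γ a b c d eq
    with diagonal-terms-bounded α β γ (3 ℕ.* γ) (ℤₚ.+-injective (trans (sym (form-abs α β γ a b c d)) eq))
    where instance
      3γ≢0 : NonZero (3 ℕ.* γ)
      3γ≢0 = ℕₚ.m*n≢0 3 γ
  ... | a≤ , b≤ , c≤ , d≤ = ≤-square a≤ , ≤-square b≤ , ≤-square c≤ , ≤-square d≤
    where
    ≤-square : ∀ {m K} → m ℕ.* m ℕ.≤ K → m ℕ.≤ K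
    ≤-square {zero}  _  = z≤n
    ≤-square {suc m} le = ℕₚ.≤-trans (ℕₚ.m≤m*n (suc m) (suc m)) le

  Rep OddRep MixedRep : ℕ → ℕ → ℕ → ℕ → ℤ → ℤ → ℤ → Set
  Rep      α β γ K a b s = form α β γ a b s ≡ + K
  OddRep   α β γ K a b s = Rep α β γ K a b s × Odd a × Odd b
  MixedRep α β γ K a b s = Rep α β γ K a b s × Odd (a + b)

  rep? : ∀ α β γ K a b s → Dec (Rep α β γ K a b s)
  rep? α β γ K a b s = form α β γ a b s ℤ.≟ + K

  oddRep? : ∀ α β γ K a b s → Dec (OddRep α β γ K a b s)
  oddRep? α β γ K a b s = rep? α β γ K a b s ×-dec odd? a ×-dec odd? b

  mixedRep? : ∀ α β γ K a b s → Dec (MixedRep α β γ K a b s)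
  mixedRep? α β γ K a b s = rep? α β γ K a b s ×-dec odd? (a + b)

  Rep-bounded : ∀ α β γ .{{_ : NonZero α}} .{{_ : NonZero β}} .{{_ : NonZero γ}} {K B} → K ℕ.≤ B →
                ∀ a b c d → Rep α β γ K a b (norm₃ c d) → InBox B (a , b , c , d)
  Rep-bounded α β γ K≤B a b c d = InBox-mono K≤B (a , b , c , d) ∘ form-bounded α β γ a b c d

  OddRep-bounded : ∀ α β γ .{{_ : NonZero α}} .{{_ : NonZero β}} .{{_ : NonZero γ}} {K B} → K ℕ.≤ B →
                   ∀ a b c d → OddRep α β γ K a b (norm₃ c d) → InBox B (a , b , c , d)
  OddRep-bounded α β γ K≤B a b c d = Rep-bounded α β γ K≤B a b c d ∘ proj₁

  MixedRep-bounded : ∀ α β γ .{{_ : NonZero α}} .{{_ : NonZero β}} .{{_ : NonZero γ}} {K B} → K ℕ.≤ B →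
                     ∀ a b c d → MixedRep α β γ K a b (norm₃ c d) → InBox B (a , b , c , d)
  MixedRep-bounded α β γ K≤B a b c d = Rep-bounded α β γ K≤B a b c d ∘ proj₁

  OddPair MixedPair DoubledMixedPair : Pred (ℤ × ℤ) 0ℓ
  OddPair = Odd ⟨×⟩ Odd
  MixedPair (c , d) = Odd (c + d)
  DoubledMixedPair (c , d) = ∃₂ λ p q → c ≡ + 2 * p × d ≡ + 2 * q × Odd (p + q)

  mixedPair? : Decidable MixedPair
  mixedPair? (c , d) = odd? (c + d)

  doubledMixedPair? : Decidable DoubledMixedPair
  doubledMixedPair? (c , d) with even-or-odd c | even-or-odd d
  ... | inj₂ c-odd      | _               = no λ (p , _ , c≡2p , _) → even⇒¬odd (p , c≡2p) c-odd
  ... | inj₁ _          | inj₂ d-odd      = no λ (_ , q , _ , d≡2q , _) → even⇒¬odd (q , d≡2q) d-odd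
  ... | inj₁ (p , refl) | inj₁ (q , refl) with odd? (p + q)
  ...   | yes p+q-odd  = yes (p , q , refl , refl , p+q-odd)
  ...   | no  p+q-even = no λ (p′ , q′ , 2p≡2p′ , 2q≡2q′ , p′+q′-odd) →
          p+q-even (subst₂ (λ p q → Odd (p + q)) (sym (2*-injective 2p≡2p′)) (sym (2*-injective 2q≡2q′)) p′+q′-odd)
    where
    2*-injective : ∀ {x y} → + 2 * x ≡ + 2 * y → x ≡ y
    2*-injective {x} {y} = ℤₚ.*-cancelˡ-≡ (+ 2) x y

  Sol : (ℤ → ℤ → ℤ → Set) → Pred (ℤ × ℤ) 0ℓ → Pred Z4 0ℓ
  Sol φ C (a , b , c , d) = φ a b (norm₃ c d) × C (c , d)

  sol? : ∀ {φ C} → (∀ a b s → Dec (φ a b s)) → Decidable C → Decidable (Sol φ C)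
  sol? φ? C? (a , b , c , d) = φ? a b (norm₃ c d) ×-dec C? (c , d)

  Sol-bounded : ∀ {B} φ → (∀ a b c d → φ a b (norm₃ c d) → InBox B (a , b , c , d)) → ∀ C → Bounded B (Sol φ C)
  Sol-bounded φ bounded C (a , b , c , d) (φ-sol , _) = bounded a b c d φ-sol

  -- The rotation by a cube root of unity

  eisensteinNorm : ℤ → ℤ → ℤ
  eisensteinNorm d e = d * d + d * e + e * e
  {-# INLINE eisensteinNorm #-}

  norm₃-reparam : ∀ d e → norm₃ (d + + 2 * e) d ≡ + 4 * eisensteinNorm d e
  norm₃-reparam = solve-∀

  eisensteinNorm-rotate : ∀ d e → eisensteinNorm e (- (d + e)) ≡ eisensteinNorm d e
  eisensteinNorm-rotate = solve-∀

  eisensteinNorm-rotate⁻¹ : ∀ d e → eisensteinNorm (- (d + e)) d ≡ eisensteinNorm d e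
  eisensteinNorm-rotate⁻¹ = solve-∀

  rotate rotate⁻¹ reparam : Z4 → Z4
  rotate   (a , b , d , e) = a , b , e , - (d + e)
  rotate⁻¹ (a , b , d , e) = a , b , - (d + e) , d
  reparam  (a , b , d , e) = a , b , d + + 2 * e , d

  rotate⁻¹-rotate : ∀ z → rotate⁻¹ (rotate z) ≡ z
  rotate⁻¹-rotate (a , b , d , e) = Z4-≡ refl refl (lemma d e) refl
    where
    lemma : ∀ d e → - (e + - (d + e)) ≡ d
    lemma = solve-∀

  rotate-rotate⁻¹ : ∀ z → rotate (rotate⁻¹ z) ≡ z
  rotate-rotate⁻¹ (a , b , d , e) = Z4-≡ refl refl refl (lemma d e)
    where
    lemma : ∀ d e → - (- (d + e) + d) ≡ e
    lemma = solve-∀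

  2e≡[d+2e]-d : ∀ d e → + 2 * e ≡ (d + + 2 * e) - d
  2e≡[d+2e]-d = solve-∀

  reparam-injective : ∀ {x y} → reparam x ≡ reparam y → x ≡ y
  reparam-injective {a , b , d , e} {a′ , b′ , d′ , e′} eq =
    Z4-≡ (cong proj₁ eq) (cong (proj₁ ∘ proj₂) eq) d≡d′ (ℤₚ.*-cancelˡ-≡ (+ 2) e e′ (begin
      + 2 * e               ≡⟨ 2e≡[d+2e]-d d e ⟩
      (d + + 2 * e) - d     ≡⟨ cong₂ _-_ (cong (proj₁ ∘ proj₂ ∘ proj₂) eq) d≡d′ ⟩
      (d′ + + 2 * e′) - d′  ≡⟨ 2e≡[d+2e]-d d′ e′ ⟨
      + 2 * e′              ∎))
    where
    d≡d′ = cong (proj₂ ∘ proj₂ ∘ proj₂) eq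

  ∣e∣≤B : ∀ {B} d e → ∣ d + + 2 * e ∣ ℕ.≤ B → ∣ d ∣ ℕ.≤ B → ∣ e ∣ ℕ.≤ B
  ∣e∣≤B {B} d e c≤ d≤ = ℕₚ.*-cancelˡ-≤ 2
    (subst₂ ℕ._≤_ ∣2e∣≡2∣e∣ (cong (B ℕ.+_) (sym (ℕₚ.+-identityʳ B)))
            (ℕₚ.≤-trans (ℤₚ.∣i-j∣≤∣i∣+∣j∣ (d + + 2 * e) d) (ℕₚ.+-mono-≤ c≤ d≤)))
    where
    ∣2e∣≡2∣e∣ : ∣ (d + + 2 * e) - d ∣ ≡ 2 ℕ.* ∣ e ∣
    ∣2e∣≡2∣e∣ = trans (cong ∣_∣ (sym (2e≡[d+2e]-d d e))) (ℤₚ.abs-* (+ 2) e)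

  -- In the coordinates c = d + 2e of a pair with c ≡ d (mod 2), c² + 3d² = 4(d² + de + e²) and
  -- multiplication by a primitive cube root of unity is (d, e) ↦ (e, −d − e).  It permutes the parity
  -- classes (1,0) → (0,1) → (1,1) of (d, e); odd pairs (c, d) form the classes (1,0) and (1,1), doubled
  -- mixed pairs the class (0,1).
  module Rotation (φ : ℤ → ℤ → ℤ → Set) (φ? : ∀ a b s → Dec (φ a b s)) {B : ℕ}
                  (bounded : ∀ a b c d → φ a b (norm₃ c d) → InBox B (a , b , c , d)) where

    Sol′ : Pred (ℤ × ℤ) 0ℓ → Pred Z4 0ℓ
    Sol′ D (a , b , d , e) = φ a b (+ 4 * eisensteinNorm d e) × D (d , e)

    sol′? : ∀ {D} → Decidable D → Decidable (Sol′ D)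
    sol′? D? (a , b , d , e) = φ? a b (+ 4 * eisensteinNorm d e) ×-dec D? (d , e)

    from-norm₃ : ∀ {a b c} d e → d + + 2 * e ≡ c → φ a b (norm₃ c d) → φ a b (+ 4 * eisensteinNorm d e)
    from-norm₃ {a} {b} d e refl = subst (φ a b) (norm₃-reparam d e)

    to-norm₃ : ∀ {a b} d e → φ a b (+ 4 * eisensteinNorm d e) → φ a b (norm₃ (d + + 2 * e) d)
    to-norm₃ {a} {b} d e = subst (φ a b) (sym (norm₃-reparam d e))

    Sol′-bounded : ∀ D → Bounded B (Sol′ D)
    Sol′-bounded D (a , b , d , e) (φ-sol , _) with bounded a b (d + + 2 * e) d (to-norm₃ d e φ-sol)
    ... | a≤ , b≤ , c≤ , d≤ = a≤ , b≤ , d≤ , ∣e∣≤B d e c≤ d≤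

    rotate-preserves : ∀ {a b} d e → φ a b (+ 4 * eisensteinNorm d e) → φ a b (+ 4 * eisensteinNorm e (- (d + e)))
    rotate-preserves {a} {b} d e = subst (λ n → φ a b (+ 4 * n)) (sym (eisensteinNorm-rotate d e))

    rotate⁻¹-preserves : ∀ {a b} d e → φ a b (+ 4 * eisensteinNorm d e) → φ a b (+ 4 * eisensteinNorm (- (d + e)) d)
    rotate⁻¹-preserves {a} {b} d e = subst (λ n → φ a b (+ 4 * n)) (sym (eisensteinNorm-rotate⁻¹ d e))

    reparam-odd : Sol′ (Odd ⟨×⟩ U) ⇿ Sol φ OddPair
    reparam-odd = record
      { to         = reparam
      ; to-∈       = λ { {a , b , d , e} (φ-sol , d-odd , _) →
                       to-norm₃ d e φ-sol , +-odd-even d-odd (twice-even e) , d-odd }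
      ; injective  = λ _ _ → reparam-injective
      ; surjective = preimage
      }
      where
      c≡ : ∀ i j → (+ 1 + + 2 * j) + + 2 * (i - j) ≡ + 1 + + 2 * i
      c≡ = solve-∀
      preimage : ∀ {z} → Sol φ OddPair z → ∃[ y ] Sol′ (Odd ⟨×⟩ U) y × reparam y ≡ z
      preimage {a , b , _ , _} (φ-sol , (i , refl) , (j , refl)) =
        (a , b , + 1 + + 2 * j , i - j) ,
        (from-norm₃ (+ 1 + + 2 * j) (i - j) (c≡ i j) φ-sol , (j , refl) , _) ,
        Z4-≡ refl refl (c≡ i j) refl

    reparam-mixed : Sol′ (Even ⟨×⟩ Odd) ⇿ Sol φ DoubledMixedPair
    reparam-mixed = record
      { to         = reparam
      ; to-∈       = image
      ; injective  = λ _ _ → reparam-injective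
      ; surjective = preimage
      }
      where
      c≡ : ∀ q e → + 2 * q + + 2 * e ≡ + 2 * (q + e)
      c≡ = solve-∀
      sum≡ : ∀ q e → e + + 2 * q ≡ q + e + q
      sum≡ = solve-∀
      image : Sol′ (Even ⟨×⟩ Odd) ⊆ Sol φ DoubledMixedPair ∘ reparam
      image {a , b , _ , e} (φ-sol , (q , refl) , e-odd) =
        to-norm₃ (+ 2 * q) e φ-sol , q + e , q , c≡ q e , refl , subst Odd (sum≡ q e) (+-odd-even e-odd (twice-even q))
      c≡′ : ∀ p q → + 2 * q + + 2 * (p - q) ≡ + 2 * p
      c≡′ = solve-∀
      preimage : ∀ {z} → Sol φ DoubledMixedPair z → ∃[ y ] Sol′ (Even ⟨×⟩ Odd) y × reparam y ≡ z
      preimage {a , b , _ , _} (φ-sol , p , q , refl , refl , p+q-odd) =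
        (a , b , + 2 * q , p - q) ,
        (from-norm₃ (+ 2 * q) (p - q) (c≡′ p q) φ-sol , twice-even q , odd-sum⇒odd-diff p q p+q-odd) ,
        Z4-≡ refl refl (c≡′ p q) refl

    rotate-oddEven : Sol′ (Odd ⟨×⟩ Even) ⇿ Sol′ (Even ⟨×⟩ Odd)
    rotate-oddEven = inverses⇒⇿ rotate rotate⁻¹
      (λ { {a , b , d , e} (φ-sol , d-odd , e-even) →
           rotate-preserves d e φ-sol , e-even , neg-odd (+-odd-even d-odd e-even) })
      (λ { {a , b , d , e} (φ-sol , d-even , e-odd) →
           rotate⁻¹-preserves d e φ-sol , neg-odd (+-even-odd d-even e-odd) , d-even })
      rotate⁻¹-rotate rotate-rotate⁻¹

    rotate-evenOdd : Sol′ (Even ⟨×⟩ Odd) ⇿ Sol′ (Odd ⟨×⟩ Odd)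
    rotate-evenOdd = inverses⇒⇿ rotate rotate⁻¹
      (λ { {a , b , d , e} (φ-sol , d-even , e-odd) →
           rotate-preserves d e φ-sol , e-odd , neg-odd (+-even-odd d-even e-odd) })
      (λ { {a , b , d , e} (φ-sol , d-odd , e-odd) →
           rotate⁻¹-preserves d e φ-sol , neg-even (+-odd-odd d-odd e-odd) , d-odd })
      rotate⁻¹-rotate rotate-rotate⁻¹

    count-OddPair≡2*count-DoubledMixedPair :
      count B (sol? φ? (odd? ×? odd?)) ≡ 2 ℕ.* count B (sol? φ? doubledMixedPair?)
    count-OddPair≡2*count-DoubledMixedPair = begin
      count B (sol? φ? (odd? ×? odd?))
        ≡⟨ count-⇿ _ _ (Sol′-bounded (Odd ⟨×⟩ U)) (Sol-bounded φ bounded OddPair) reparam-odd ⟨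
      count B (sol′? (odd? ×? U?))
        ≡⟨ count-⊎ B _ (sol′? (odd? ×? even?)) (sol′? (odd? ×? odd?)) split (forget Even) (forget Odd) disjoint ⟩
      count B (sol′? (odd? ×? even?)) ℕ.+ count B (sol′? (odd? ×? odd?))
        ≡⟨ cong₂ ℕ._+_ (count-⇿ _ _ (Sol′-bounded (Odd ⟨×⟩ Even)) (Sol′-bounded (Even ⟨×⟩ Odd)) rotate-oddEven)
                       (sym (count-⇿ _ _ (Sol′-bounded (Even ⟨×⟩ Odd)) (Sol′-bounded (Odd ⟨×⟩ Odd)) rotate-evenOdd)) ⟩
      count B (sol′? (even? ×? odd?)) ℕ.+ count B (sol′? (even? ×? odd?))
        ≡⟨ cong (count B (sol′? (even? ×? odd?)) ℕ.+_) (ℕₚ.+-identityʳ _) ⟨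
      2 ℕ.* count B (sol′? (even? ×? odd?))
        ≡⟨ cong (2 ℕ.*_) (count-⇿ _ _ (Sol′-bounded (Even ⟨×⟩ Odd)) (Sol-bounded φ bounded DoubledMixedPair) reparam-mixed) ⟩
      2 ℕ.* count B (sol? φ? doubledMixedPair?) ∎
      where
      split : ∀ z → Sol′ (Odd ⟨×⟩ U) z → Sol′ (Odd ⟨×⟩ Even) z ⊎ Sol′ (Odd ⟨×⟩ Odd) z
      split (a , b , d , e) (φ-sol , d-odd , _) =
        Sum.map (λ e-even → φ-sol , d-odd , e-even) (λ e-odd → φ-sol , d-odd , e-odd) (even-or-odd e)
      forget : ∀ E z → Sol′ (Odd ⟨×⟩ E) z → Sol′ (Odd ⟨×⟩ U) z
      forget E (a , b , d , e) (φ-sol , d-odd , _) = φ-sol , d-odd , _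
      disjoint : ∀ z → Sol′ (Odd ⟨×⟩ Even) z → ¬ Sol′ (Odd ⟨×⟩ Odd) z
      disjoint (a , b , d , e) (_ , _ , e-even) (_ , _ , e-odd) = even⇒¬odd e-even e-odd

  -- Congruences modulo 8

  form₂₂₃≡6-mod-8⇒OddPair⊎DoubledMixedPair : ∀ a b c d κ → form 2 2 3 a b (norm₃ c d) ≡ + 6 + + 8 * κ →
                                             OddPair (c , d) ⊎ DoubledMixedPair (c , d)
  form₂₂₃≡6-mod-8⇒OddPair⊎DoubledMixedPair a b c d κ eq with even-or-odd c | even-or-odd d
  ... | inj₂ c-odd      | inj₂ d-odd      = inj₁ (c-odd , d-odd)
  ... | inj₂ (i , refl) | inj₁ (j , refl) =
    ⊥-elim (even≢odd (+ 3 + + 4 * κ) (a * a + b * b + + 1 + + 6 * i + + 6 * (i * i) + + 18 * (j * j)) (begin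
    + 2 * (+ 3 + + 4 * κ)                                                       ≡⟨ solve (κ ∷ []) ⟩
    + 6 + + 8 * κ                                                               ≡⟨ eq ⟨
    form 2 2 3 a b (norm₃ (+ 1 + + 2 * i) (+ 2 * j))                            ≡⟨ solve (a ∷ b ∷ i ∷ j ∷ []) ⟩
    + 1 + + 2 * (a * a + b * b + + 1 + + 6 * i + + 6 * (i * i) + + 18 * (j * j)) ∎))
  ... | inj₁ (i , refl) | inj₂ (j , refl) =
    ⊥-elim (even≢odd (+ 3 + + 4 * κ) (a * a + b * b + + 4 + + 6 * (i * i) + + 18 * j + + 18 * (j * j)) (begin
    + 2 * (+ 3 + + 4 * κ)                                                       ≡⟨ solve (κ ∷ []) ⟩
    + 6 + + 8 * κ                                                               ≡⟨ eq ⟨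
    form 2 2 3 a b (norm₃ (+ 2 * i) (+ 1 + + 2 * j))                            ≡⟨ solve (a ∷ b ∷ i ∷ j ∷ []) ⟩
    + 1 + + 2 * (a * a + b * b + + 4 + + 6 * (i * i) + + 18 * j + + 18 * (j * j)) ∎))
  ... | inj₁ (p , refl) | inj₁ (q , refl) with even-or-odd p | even-or-odd q
  ...   | inj₂ p-odd      | inj₁ q-even     = inj₂ (p , q , refl , refl , +-odd-even p-odd q-even)
  ...   | inj₁ p-even     | inj₂ q-odd      = inj₂ (p , q , refl , refl , +-even-odd p-even q-odd)
  ...   | inj₁ (r , refl) | inj₁ (s , refl) =
    ⊥-elim (sum-of-two-squares≢3-mod-4 a b (κ - + 6 * (r * r) - + 18 * (s * s)) (ℤₚ.*-cancelˡ-≡ (+ 2) _ _ (begin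
      + 2 * (a * a + b * b)
        ≡⟨ solve (a ∷ b ∷ r ∷ s ∷ []) ⟩
      form 2 2 3 a b (norm₃ (+ 2 * (+ 2 * r)) (+ 2 * (+ 2 * s))) - (+ 48 * (r * r) + + 144 * (s * s))
        ≡⟨ cong (_- (+ 48 * (r * r) + + 144 * (s * s))) eq ⟩
      + 6 + + 8 * κ - (+ 48 * (r * r) + + 144 * (s * s))
        ≡⟨ solve (κ ∷ r ∷ s ∷ []) ⟩
      + 2 * (+ 3 + + 4 * (κ - + 6 * (r * r) - + 18 * (s * s))) ∎)))
  ...   | inj₂ (r , refl) | inj₂ (s , refl) =
    ⊥-elim (sum-of-two-squares≢3-mod-4 a b (κ - + 6 - + 6 * r - + 6 * (r * r) - + 18 * s - + 18 * (s * s))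
      (ℤₚ.*-cancelˡ-≡ (+ 2) _ _ (begin
      + 2 * (a * a + b * b)
        ≡⟨ solve (a ∷ b ∷ r ∷ s ∷ []) ⟩
      form 2 2 3 a b (norm₃ (+ 2 * (+ 1 + + 2 * r)) (+ 2 * (+ 1 + + 2 * s))) - (+ 48 + + 48 * r + + 48 * (r * r) + + 144 * s + + 144 * (s * s))
        ≡⟨ cong (_- (+ 48 + + 48 * r + + 48 * (r * r) + + 144 * s + + 144 * (s * s))) eq ⟩
      + 6 + + 8 * κ - (+ 48 + + 48 * r + + 48 * (r * r) + + 144 * s + + 144 * (s * s))
        ≡⟨ solve (κ ∷ r ∷ s ∷ []) ⟩
      + 2 * (+ 3 + + 4 * (κ - + 6 - + 6 * r - + 6 * (r * r) - + 18 * s - + 18 * (s * s))) ∎)))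

  form₂₂₃≡6-mod-8⇒odd-sum : ∀ a b c d κ → form 2 2 3 a b (norm₃ c d) ≡ + 6 + + 8 * κ →
                            DoubledMixedPair (c , d) → Odd (a + b)
  form₂₂₃≡6-mod-8⇒odd-sum a b _ _ κ eq (p , q , refl , refl , _) with even-or-odd a | even-or-odd b
  ... | inj₂ a-odd  | inj₁ b-even = +-odd-even a-odd b-even
  ... | inj₁ a-even | inj₂ b-odd  = +-even-odd a-even b-odd
  ... | inj₂ (i , refl) | inj₂ (k , refl) =
    ⊥-elim (r+m*2h≢r+m*[1+2k] 2 (+ 0) (+ 1 + + 2 * i + + 2 * (i * i) + + 2 * k + + 2 * (k * k) + + 3 * (p * p) + + 9 * (q * q))
      (+ 1 + + 2 * κ) (begin
      + 0 + + 2 * (+ 2 * (+ 1 + + 2 * i + + 2 * (i * i) + + 2 * k + + 2 * (k * k) + + 3 * (p * p) + + 9 * (q * q)))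
        ≡⟨ solve (i ∷ k ∷ p ∷ q ∷ []) ⟩
      form 2 2 3 (+ 1 + + 2 * i) (+ 1 + + 2 * k) (norm₃ (+ 2 * p) (+ 2 * q))
        ≡⟨ eq ⟩
      + 6 + + 8 * κ
        ≡⟨ solve (κ ∷ []) ⟩
      + 0 + + 2 * (+ 1 + + 2 * (+ 1 + + 2 * κ)) ∎))
  ... | inj₁ (i , refl) | inj₁ (k , refl) =
    ⊥-elim (r+m*2h≢r+m*[1+2k] 2 (+ 0) (+ 2 * (i * i) + + 2 * (k * k) + + 3 * (p * p) + + 9 * (q * q)) (+ 1 + + 2 * κ) (begin
      + 0 + + 2 * (+ 2 * (+ 2 * (i * i) + + 2 * (k * k) + + 3 * (p * p) + + 9 * (q * q)))
        ≡⟨ solve (i ∷ k ∷ p ∷ q ∷ []) ⟩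
      form 2 2 3 (+ 2 * i) (+ 2 * k) (norm₃ (+ 2 * p) (+ 2 * q))
        ≡⟨ eq ⟩
      + 6 + + 8 * κ
        ≡⟨ solve (κ ∷ []) ⟩
      + 0 + + 2 * (+ 1 + + 2 * (+ 1 + + 2 * κ)) ∎))

  form₁₁₃≡6-mod-8⇒even-odd : ∀ u w c d κ → form 1 1 3 u w (norm₃ c d) ≡ + 6 + + 8 * κ →
                             Odd u → Even w → Odd (c + d) → Even c × Odd d
  form₁₁₃≡6-mod-8⇒even-odd _ _ c d κ eq (i , refl) (j , refl) c+d-odd with even-or-odd c | even-or-odd d
  ... | inj₁ c-even | inj₂ d-odd  = c-even , d-odd
  ... | inj₂ c-odd  | inj₂ d-odd  = ⊥-elim (even⇒¬odd (+-odd-odd c-odd d-odd) c+d-odd)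
  ... | inj₁ c-even | inj₁ d-even = ⊥-elim (even⇒¬odd (+-even-even c-even d-even) c+d-odd)
  ... | inj₂ (p , refl) | inj₁ (q , refl) =
    ⊥-elim (r+m*2h≢r+m*[1+2k] 2 (+ 0) (+ 1 + i + i * i + j * j + + 3 * p + + 3 * (p * p) + + 9 * (q * q)) (+ 1 + + 2 * κ) (begin
      + 0 + + 2 * (+ 2 * (+ 1 + i + i * i + j * j + + 3 * p + + 3 * (p * p) + + 9 * (q * q)))
        ≡⟨ solve (i ∷ j ∷ p ∷ q ∷ []) ⟩
      form 1 1 3 (+ 1 + + 2 * i) (+ 2 * j) (norm₃ (+ 1 + + 2 * p) (+ 2 * q))
        ≡⟨ eq ⟩
      + 6 + + 8 * κ
        ≡⟨ solve (κ ∷ []) ⟩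
      + 0 + + 2 * (+ 1 + + 2 * (+ 1 + + 2 * κ)) ∎))

  form₁₁₃≡6-mod-8⇒DoubledMixedPair : ∀ u w c d κ → form 1 1 3 u w (norm₃ c d) ≡ + 6 + + 8 * κ →
                                     Odd u → Even w → Even c → Odd d → DoubledMixedPair (w , c)
  form₁₁₃≡6-mod-8⇒DoubledMixedPair u _ _ d κ eq u-odd (j , refl) (p , refl) d-odd
    with odd-square u-odd | odd-square d-odd | even-or-odd j | even-or-odd p
  ... | _ | _ | inj₂ j-odd  | inj₁ p-even = j , p , refl , refl , +-odd-even j-odd p-even
  ... | _ | _ | inj₁ j-even | inj₂ p-odd  = j , p , refl , refl , +-even-odd j-even p-odd
  ... | s , u²≡ | t , d²≡ | inj₁ (r , refl) | inj₁ (r′ , refl) =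
    ⊥-elim (r+m*2h≢r+m*[1+2k] 4 (+ 2) (+ 1 + s + + 9 * t + + 2 * (r * r) + + 6 * (r′ * r′)) κ (begin
      + 2 + + 4 * (+ 2 * (+ 1 + s + + 9 * t + + 2 * (r * r) + + 6 * (r′ * r′)))
        ≡⟨ solve (s ∷ t ∷ r ∷ r′ ∷ []) ⟩
      + 1 * (+ 1 + + 8 * s) + + 1 * ((+ 2 * (+ 2 * r)) * (+ 2 * (+ 2 * r))) +
      + 3 * ((+ 2 * (+ 2 * r′)) * (+ 2 * (+ 2 * r′)) + + 3 * (+ 1 + + 8 * t))
        ≡⟨ cong₂ (λ U D → + 1 * U + + 1 * ((+ 2 * (+ 2 * r)) * (+ 2 * (+ 2 * r))) +
                          + 3 * ((+ 2 * (+ 2 * r′)) * (+ 2 * (+ 2 * r′)) + + 3 * D)) u²≡ d²≡ ⟨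
      form 1 1 3 u (+ 2 * (+ 2 * r)) (norm₃ (+ 2 * (+ 2 * r′)) d)
        ≡⟨ eq ⟩
      + 6 + + 8 * κ
        ≡⟨ solve (κ ∷ []) ⟩
      + 2 + + 4 * (+ 1 + + 2 * κ) ∎))
  ... | s , u²≡ | t , d²≡ | inj₂ (r , refl) | inj₂ (r′ , refl) =
    ⊥-elim (r+m*2h≢r+m*[1+2k] 4 (+ 2) (+ 3 + s + + 9 * t + + 2 * r + + 2 * (r * r) + + 6 * r′ + + 6 * (r′ * r′)) κ (begin
      + 2 + + 4 * (+ 2 * (+ 3 + s + + 9 * t + + 2 * r + + 2 * (r * r) + + 6 * r′ + + 6 * (r′ * r′)))
        ≡⟨ solve (s ∷ t ∷ r ∷ r′ ∷ []) ⟩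
      + 1 * (+ 1 + + 8 * s) + + 1 * ((+ 2 * (+ 1 + + 2 * r)) * (+ 2 * (+ 1 + + 2 * r))) +
      + 3 * ((+ 2 * (+ 1 + + 2 * r′)) * (+ 2 * (+ 1 + + 2 * r′)) + + 3 * (+ 1 + + 8 * t))
        ≡⟨ cong₂ (λ U D → + 1 * U + + 1 * ((+ 2 * (+ 1 + + 2 * r)) * (+ 2 * (+ 1 + + 2 * r))) +
                          + 3 * ((+ 2 * (+ 1 + + 2 * r′)) * (+ 2 * (+ 1 + + 2 * r′)) + + 3 * D)) u²≡ d²≡ ⟨
      form 1 1 3 u (+ 2 * (+ 1 + + 2 * r)) (norm₃ (+ 2 * (+ 1 + + 2 * r′)) d)
        ≡⟨ eq ⟩
      + 6 + + 8 * κ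
        ≡⟨ solve (κ ∷ []) ⟩
      + 2 + + 4 * (+ 1 + + 2 * κ) ∎))

  -- Triangular numbers

  triangular : ℕ → ℕ
  triangular zero    = zero
  triangular (suc m) = suc m ℕ.+ triangular m

  m*[1+m]≡triangular*2 : ∀ m → m ℕ.* suc m ≡ triangular m ℕ.* 2
  m*[1+m]≡triangular*2 zero    = refl
  m*[1+m]≡triangular*2 (suc m) = begin
    suc m ℕ.* suc (suc m)               ≡⟨ step m ⟩
    m ℕ.* suc m ℕ.+ suc m ℕ.* 2         ≡⟨ cong (ℕ._+ suc m ℕ.* 2) (m*[1+m]≡triangular*2 m) ⟩
    triangular m ℕ.* 2 ℕ.+ suc m ℕ.* 2  ≡⟨ ℕₚ.*-distribʳ-+ 2 (triangular m) (suc m) ⟨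
    (triangular m ℕ.+ suc m) ℕ.* 2      ≡⟨ cong (ℕ._* 2) (ℕₚ.+-comm (triangular m) (suc m)) ⟩
    triangular (suc m) ℕ.* 2            ∎
    where
    step : ∀ m → suc m ℕ.* suc (suc m) ≡ m ℕ.* suc m ℕ.+ suc m ℕ.* 2
    step = ℕ-Solver.solve-∀

  m≤triangular : ∀ m → m ℕ.≤ triangular m
  m≤triangular zero    = z≤n
  m≤triangular (suc m) = ℕₚ.m≤m+n (suc m) (triangular m)

  private
    triangular-index : ∀ x → ∃[ m ] x * (x - + 1) ≡ + (m ℕ.* suc m) × ∣ x ∣ ℕ.≤ suc m
    triangular-index (+ zero)  = 0 , refl , z≤n
    triangular-index (+ suc j) = j , trans (sym (ℤₚ.pos-* (suc j) j)) (cong +_ (ℕₚ.*-comm (suc j) j)) , ℕₚ.≤-refl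
    triangular-index -[1+ j ]  = suc j , cong (λ i → + (suc j ℕ.* suc (suc i))) (ℕₚ.+-identityʳ j) , ℕₚ.n≤1+n (suc j)

    tri≡triangular : ∀ x m → x * (x - + 1) ≡ + (m ℕ.* suc m) → tri x ≡ triangular m
    tri≡triangular x m eq = trans (cong (λ y → ∣ y ∣ ℕ./ 2) eq)
      (trans (cong (ℕ._/ 2) (m*[1+m]≡triangular*2 m)) (m*n/n≡m (triangular m) 2))

  x[x-1]≡2*tri : ∀ x → x * (x - + 1) ≡ + 2 * + tri x
  x[x-1]≡2*tri x with m , eq , _ ← triangular-index x = begin
    x * (x - + 1)           ≡⟨ eq ⟩
    + (m ℕ.* suc m)         ≡⟨ cong +_ (trans (m*[1+m]≡triangular*2 m) (ℕₚ.*-comm (triangular m) 2)) ⟩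
    + (2 ℕ.* triangular m)  ≡⟨ ℤₚ.pos-* 2 (triangular m) ⟩
    + 2 * + triangular m    ≡⟨ cong (λ y → + 2 * + y) (tri≡triangular x m eq) ⟨
    + 2 * + tri x           ∎

  ∣x∣≤1+tri : ∀ x → ∣ x ∣ ℕ.≤ suc (tri x)
  ∣x∣≤1+tri x with m , eq , ∣x∣≤1+m ← triangular-index x =
    ℕₚ.≤-trans ∣x∣≤1+m (s≤s (subst (m ℕ.≤_) (sym (tri≡triangular x m eq)) (m≤triangular m)))

  odd-of : ℤ → ℤ
  odd-of x = + 1 + + 2 * (x - + 1)
  {-# INLINE odd-of #-}

  odd-of-odd : ∀ x → Odd (odd-of x)
  odd-of-odd x = x - + 1 , refl

  odd-of-injective : ∀ {x y} → odd-of x ≡ odd-of y → x ≡ y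
  odd-of-injective {x} {y} = +-cancelʳ (- + 1) x y ∘ ℤₚ.*-cancelˡ-≡ (+ 2) _ _ ∘ +-cancelˡ (+ 1) _ _

  odd-of-suc : ∀ i → odd-of (i + + 1) ≡ + 1 + + 2 * i
  odd-of-suc = solve-∀

  odd-of-square : ∀ x → odd-of x * odd-of x ≡ + 1 + + 8 * + tri x
  odd-of-square x = begin
    odd-of x * odd-of x          ≡⟨ solve (x ∷ []) ⟩
    + 1 + + 4 * (x * (x - + 1))  ≡⟨ cong (λ y → + 1 + + 4 * y) (x[x-1]≡2*tri x) ⟩
    + 1 + + 4 * (+ 2 * + tri x)  ≡⟨ cong (_+_ (+ 1)) (ℤₚ.*-assoc (+ 4) (+ 2) (+ tri x)) ⟨
    + 1 + + 8 * + tri x          ∎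

  -- Changes of variables between representation counts

  sum-diff-injective : ∀ {a b a′ b′} → a + b ≡ a′ + b′ → a - b ≡ a′ - b′ → a ≡ a′ × b ≡ b′
  sum-diff-injective {a} {b} {a′} {b′} s≡ d≡ =
    ℤₚ.*-cancelˡ-≡ (+ 2) a a′ (begin
      + 2 * a                ≡⟨ solve (a ∷ b ∷ []) ⟩
      (a + b) + (a - b)      ≡⟨ cong₂ _+_ s≡ d≡ ⟩
      (a′ + b′) + (a′ - b′)  ≡⟨ solve (a′ ∷ b′ ∷ []) ⟩
      + 2 * a′               ∎) ,
    ℤₚ.*-cancelˡ-≡ (+ 2) b b′ (begin
      + 2 * b                ≡⟨ solve (a ∷ b ∷ []) ⟩
      (a + b) - (a - b)      ≡⟨ cong₂ _-_ s≡ d≡ ⟩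
      (a′ + b′) - (a′ - b′)  ≡⟨ solve (a′ ∷ b′ ∷ []) ⟩
      + 2 * b′               ∎)

  sum-of-halves : ∀ i j → (+ 1 + i + j) + (i - j) ≡ + 1 + + 2 * i
  sum-of-halves = solve-∀

  diff-of-halves : ∀ i j → (+ 1 + i + j) - (i - j) ≡ + 1 + + 2 * j
  diff-of-halves = solve-∀

  form₁₁₃-sum-diff : ∀ a b s → form 1 1 3 (a + b) (a - b) s ≡ form 2 2 3 a b s
  form₁₁₃-sum-diff = solve-∀

  form₂₂₃-double : ∀ u w c d → form 2 2 3 (u + w) (u - w) (norm₃ (+ 2 * c) (+ 2 * d)) ≡ + 4 * form 1 1 3 u w (norm₃ c d)
  form₂₂₃-double = solve-∀

  form₁₁₃-swap : ∀ u w s → form 1 1 3 w u s ≡ form 1 1 3 u w s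
  form₁₁₃-swap = solve-∀

  form₁₉₁-regroup : ∀ u w c d → form 1 9 1 u d (norm₃ w c) ≡ form 1 1 3 u w (norm₃ c d)
  form₁₉₁-regroup = solve-∀

  sqSum triSum : Z4 → ℕ
  sqSum  (x , y , z , w) = 2 ℕ.* sq x ℕ.+ 2 ℕ.* sq y ℕ.+ 3 ℕ.* sq z ℕ.+ 9 ℕ.* sq w
  triSum (x , y , z , w) = 2 ℕ.* tri x ℕ.+ 2 ℕ.* tri y ℕ.+ 3 ℕ.* tri z ℕ.+ 9 ℕ.* tri w

  SqRep TriRep : ℕ → Pred Z4 0ℓ
  SqRep  K z = sqSum z ≡ K
  TriRep K z = triSum z ≡ K

  sqRep? : ∀ K → Decidable (SqRep K)
  sqRep? K z = sqSum z ℕ.≟ K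

  triRep? : ∀ K → Decidable (TriRep K)
  triRep? K z = triSum z ℕ.≟ K

  N≡count : ∀ K → N 2 2 3 9 K ≡ count (K ℕ.+ 1) (sqRep? K)
  N≡count K = count-≐ (K ℕ.+ 1) _ (sqRep? K) (λ { {_ , _ , _ , _} eq → eq }) (λ { {_ , _ , _ , _} eq → eq })

  t≡count : ∀ K → t 2 2 3 9 K ≡ count (K ℕ.+ 1) (triRep? K)
  t≡count K = count-≐ (K ℕ.+ 1) _ (triRep? K) (λ { {_ , _ , _ , _} eq → eq }) (λ { {_ , _ , _ , _} eq → eq })

  form₂₂₃₉ : Z4 → ℤ
  form₂₂₃₉ (a , b , c , d) = form 2 2 3 a b (norm₃ c d)

  +sqSum≡form₂₂₃₉ : ∀ z → + sqSum z ≡ form₂₂₃₉ z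
  +sqSum≡form₂₂₃₉ (x , y , z , w) = begin
    + sqSum (x , y , z , w)
      ≡⟨ pos-diagonal 2 2 3 9 (sq x) (sq y) (sq z) (sq w) ⟩
    + 2 * + sq x + + 2 * + sq y + + 3 * + sq z + + 9 * + sq w
      ≡⟨ cong (λ { (p , q , r , s) → + 2 * p + + 2 * q + + 3 * r + + 9 * s }) (Z4-≡ (+sq x) (+sq y) (+sq z) (+sq w)) ⟩
    + 2 * (x * x) + + 2 * (y * y) + + 3 * (z * z) + + 9 * (w * w)
      ≡⟨ solve (x ∷ y ∷ z ∷ w ∷ []) ⟩
    form 2 2 3 x y (norm₃ z w) ∎
    where
    +sq : ∀ x → + sq x ≡ x * x
    +sq x = trans (cong (λ n → + (∣ x ∣ ℕ.* n)) (ℕₚ.*-identityʳ ∣ x ∣)) (sym (square-abs x))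

  oddOf⁴ : Z4 → Z4
  oddOf⁴ (x , y , z , w) = odd-of x , odd-of y , odd-of z , odd-of w

  form₂₂₃₉-oddOf⁴ : ∀ z → form₂₂₃₉ (oddOf⁴ z) ≡ + 16 + + 8 * + triSum z
  form₂₂₃₉-oddOf⁴ (x , y , z , w) = begin
    form 2 2 3 (odd-of x) (odd-of y) (norm₃ (odd-of z) (odd-of w))
      ≡⟨ cong (λ { (p , q , r , s) → + 2 * p + + 2 * q + + 3 * (r + + 3 * s) })
              (Z4-≡ (odd-of-square x) (odd-of-square y) (odd-of-square z) (odd-of-square w)) ⟩
    + 2 * (+ 1 + + 8 * X) + + 2 * (+ 1 + + 8 * Y) + + 3 * ((+ 1 + + 8 * Z) + + 3 * (+ 1 + + 8 * W))
      ≡⟨ regroup X Y Z W ⟩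
    + 16 + + 8 * (+ 2 * X + + 2 * Y + + 3 * Z + + 9 * W)
      ≡⟨ cong (λ s → + 16 + + 8 * s) (pos-diagonal 2 2 3 9 (tri x) (tri y) (tri z) (tri w)) ⟨
    + 16 + + 8 * + triSum (x , y , z , w) ∎
    where
    X = + tri x
    Y = + tri y
    Z = + tri z
    W = + tri w
    regroup : ∀ X Y Z W → + 2 * (+ 1 + + 8 * X) + + 2 * (+ 1 + + 8 * Y) + + 3 * ((+ 1 + + 8 * Z) + + 3 * (+ 1 + + 8 * W))
                        ≡ + 16 + + 8 * (+ 2 * X + + 2 * Y + + 3 * Z + + 9 * W)
    regroup = solve-∀

  16+8n≡4*[2n+4] : ∀ n → + 16 + + 8 * + n ≡ + (4 ℕ.* (2 ℕ.* n ℕ.+ 4))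
  16+8n≡4*[2n+4] n = begin
    + 16 + + 8 * + n           ≡⟨ cong (_+_ (+ 16)) (ℤₚ.pos-* 8 n) ⟨
    + 16 + + (8 ℕ.* n)         ≡⟨ ℤₚ.pos-+ 16 (8 ℕ.* n) ⟨
    + (16 ℕ.+ 8 ℕ.* n)         ≡⟨ cong +_ (ℕ-Solver.solve (n ∷ [])) ⟩
    + (4 ℕ.* (2 ℕ.* n ℕ.+ 4))  ∎

  SqRep-bounded : ∀ K → Bounded (K ℕ.+ 1) (SqRep K)
  SqRep-bounded K z@(x , y , u , w) eq =
    Rep-bounded 2 2 3 (ℕₚ.m≤m+n K 1) x y u w (trans (sym (+sqSum≡form₂₂₃₉ z)) (cong +_ eq))

  TriRep-bounded : ∀ K → Bounded (K ℕ.+ 1) (TriRep K)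
  TriRep-bounded K (x , y , z , w) eq with x≤ , y≤ , z≤ , w≤ ← diagonal-terms-bounded 2 2 3 9 eq =
    bound x x≤ , bound y y≤ , bound z z≤ , bound w w≤
    where
    bound : ∀ x → tri x ℕ.≤ K → ∣ x ∣ ℕ.≤ K ℕ.+ 1
    bound x le = ℕₚ.≤-trans (∣x∣≤1+tri x) (subst (suc (tri x) ℕ.≤_) (ℕₚ.+-comm 1 K) (s≤s le))

  sq-⇿ : ∀ K → SqRep K ⇿ Sol (Rep 2 2 3 K) U
  sq-⇿ K = inverses⇒⇿ id id
    (λ { {z@(_ , _ , _ , _)} eq → trans (sym (+sqSum≡form₂₂₃₉ z)) (cong +_ eq) , _ })
    (λ { {z@(_ , _ , _ , _)} (eq , _) → ℤₚ.+-injective (trans (+sqSum≡form₂₂₃₉ z) eq) })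
    (λ _ → refl) (λ _ → refl)

  tri-⇿ : ∀ n → TriRep n ⇿ Sol (OddRep 2 2 3 (4 ℕ.* (2 ℕ.* n ℕ.+ 4))) OddPair
  tri-⇿ n = record
    { to         = oddOf⁴
    ; to-∈       = λ { {z@(x , y , u , w)} eq →
        (trans (form₂₂₃₉-oddOf⁴ z) (trans (cong (λ s → + 16 + + 8 * + s) eq) (16+8n≡4*[2n+4] n)) ,
         odd-of-odd x , odd-of-odd y) , odd-of-odd u , odd-of-odd w }
    ; injective  = λ _ _ eq → Z4-≡ (odd-of-injective (cong proj₁ eq)) (odd-of-injective (cong (proj₁ ∘ proj₂) eq))
                                   (odd-of-injective (cong (proj₁ ∘ proj₂ ∘ proj₂) eq))
                                   (odd-of-injective (cong (proj₂ ∘ proj₂ ∘ proj₂) eq))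
    ; surjective = preimage
    }
    where
    preimage : ∀ {z} → Sol (OddRep 2 2 3 (4 ℕ.* (2 ℕ.* n ℕ.+ 4))) OddPair z → ∃[ y ] TriRep n y × oddOf⁴ y ≡ z
    preimage ((eq , (i , refl) , (j , refl)) , (k , refl) , (l , refl)) = y , triSum≡n , oddOf⁴-y
      where
      y = i + + 1 , j + + 1 , k + + 1 , l + + 1
      oddOf⁴-y = Z4-≡ (odd-of-suc i) (odd-of-suc j) (odd-of-suc k) (odd-of-suc l)
      triSum≡n = ℤₚ.+-injective (ℤₚ.*-cancelˡ-≡ (+ 8) _ _ (+-cancelˡ (+ 16) _ _
        (trans (sym (form₂₂₃₉-oddOf⁴ y)) (trans (cong form₂₂₃₉ oddOf⁴-y) (trans eq (sym (16+8n≡4*[2n+4] n)))))))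

  sum-diff : Z4 → Z4
  sum-diff (a , b , c , d) = a + b , a - b , c , d

  sum-diff-⇿ : ∀ K κ → + K ≡ + 6 + + 8 * κ → Sol (Rep 2 2 3 K) DoubledMixedPair ⇿ Sol (OddRep 1 1 3 K) DoubledMixedPair
  sum-diff-⇿ K κ K≡6+8κ = record
    { to         = sum-diff
    ; to-∈       = λ { {a , b , c , d} (eq , cd) →
        let a+b-odd = form₂₂₃≡6-mod-8⇒odd-sum a b c d κ (trans eq K≡6+8κ) cd
        in (trans (form₁₁₃-sum-diff a b (norm₃ c d)) eq , a+b-odd , odd-sum⇒odd-diff a b a+b-odd) , cd }
    ; injective  = λ _ _ eq →
        let a≡ , b≡ = sum-diff-injective (cong proj₁ eq) (cong (proj₁ ∘ proj₂) eq)
        in Z4-≡ a≡ b≡ (cong (proj₁ ∘ proj₂ ∘ proj₂) eq) (cong (proj₂ ∘ proj₂ ∘ proj₂) eq)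
    ; surjective = preimage
    }
    where
    preimage : ∀ {z} → Sol (OddRep 1 1 3 K) DoubledMixedPair z → ∃[ y ] Sol (Rep 2 2 3 K) DoubledMixedPair y × sum-diff y ≡ z
    preimage {_ , _ , c , d} ((eq , (i , refl) , (j , refl)) , cd) =
      (+ 1 + i + j , i - j , c , d) ,
      (trans (sym (form₁₁₃-sum-diff (+ 1 + i + j) (i - j) (norm₃ c d)))
             (trans (cong₂ (λ a b → form 1 1 3 a b (norm₃ c d)) (sum-of-halves i j) (diff-of-halves i j)) eq) , cd) ,
      Z4-≡ (sum-of-halves i j) (diff-of-halves i j) refl refl

  Mixed : ℕ → Pred Z4 0ℓ
  Mixed K = Sol (MixedRep 1 1 3 K) MixedPair

  mixed? : ∀ K → Decidable (Mixed K)
  mixed? K = sol? (mixedRep? 1 1 3 K) mixedPair?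

  sum-diff-doubled : Z4 → Z4
  sum-diff-doubled (u , w , c , d) = u + w , u - w , + 2 * c , + 2 * d

  sum-diff-doubled-⇿ : ∀ K → Mixed K ⇿ Sol (OddRep 2 2 3 (4 ℕ.* K)) DoubledMixedPair
  sum-diff-doubled-⇿ K = record
    { to         = sum-diff-doubled
    ; to-∈       = λ { {u , w , c , d} ((eq , u+w-odd) , c+d-odd) →
        (trans (form₂₂₃-double u w c d) (trans (cong (+ 4 *_) eq) (sym (ℤₚ.pos-* 4 K))) ,
         u+w-odd , odd-sum⇒odd-diff u w u+w-odd) , c , d , refl , refl , c+d-odd }
    ; injective  = λ _ _ eq →
        let u≡ , w≡ = sum-diff-injective (cong proj₁ eq) (cong (proj₁ ∘ proj₂) eq)
        in Z4-≡ u≡ w≡ (ℤₚ.*-cancelˡ-≡ (+ 2) _ _ (cong (proj₁ ∘ proj₂ ∘ proj₂) eq))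
                      (ℤₚ.*-cancelˡ-≡ (+ 2) _ _ (cong (proj₂ ∘ proj₂ ∘ proj₂) eq))
    ; surjective = preimage
    }
    where
    preimage : ∀ {z} → Sol (OddRep 2 2 3 (4 ℕ.* K)) DoubledMixedPair z → ∃[ y ] Mixed K y × sum-diff-doubled y ≡ z
    preimage ((eq , (i , refl) , (j , refl)) , p , q , refl , refl , p+q-odd) =
      (+ 1 + i + j , i - j , p , q) , ((rep , i , sum-of-halves i j) , p+q-odd) ,
      Z4-≡ (sum-of-halves i j) (diff-of-halves i j) refl refl
      where
      rep : form 1 1 3 (+ 1 + i + j) (i - j) (norm₃ p q) ≡ + K
      rep = ℤₚ.*-cancelˡ-≡ (+ 4) _ _ (begin
        + 4 * form 1 1 3 (+ 1 + i + j) (i - j) (norm₃ p q)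
          ≡⟨ form₂₂₃-double (+ 1 + i + j) (i - j) p q ⟨
        form 2 2 3 (+ 1 + i + j + (i - j)) (+ 1 + i + j - (i - j)) (norm₃ (+ 2 * p) (+ 2 * q))
          ≡⟨ cong₂ (λ a b → form 2 2 3 a b (norm₃ (+ 2 * p) (+ 2 * q))) (sum-of-halves i j) (diff-of-halves i j) ⟩
        form 2 2 3 (+ 1 + + 2 * i) (+ 1 + + 2 * j) (norm₃ (+ 2 * p) (+ 2 * q))
          ≡⟨ eq ⟩
        + (4 ℕ.* K)
          ≡⟨ ℤₚ.pos-* 4 K ⟩
        + 4 * + K ∎)

  swap : Z4 → Z4
  swap (u , w , c , d) = w , u , c , d

  swap-⇿ : ∀ K → Mixed K ∩ (Odd ∘ proj₁) ⇿ Mixed K ∩ (Even ∘ proj₁)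
  swap-⇿ K = inverses⇒⇿ swap swap
    (λ { {u , w , c , d} (sol , u-odd)  → swap-sol u w c d sol , odd-sum∧odd⇒even u w (proj₂ (proj₁ sol)) u-odd })
    (λ { {u , w , c , d} (sol , u-even) → swap-sol u w c d sol , odd-sum∧even⇒odd u w (proj₂ (proj₁ sol)) u-even })
    (λ _ → refl) (λ _ → refl)
    where
    swap-sol : ∀ u w c d → Mixed K (u , w , c , d) → Mixed K (w , u , c , d)
    swap-sol u w c d ((eq , u+w-odd) , cd) =
      (trans (form₁₁₃-swap u w (norm₃ c d)) eq , subst Odd (ℤₚ.+-comm u w) u+w-odd) , cd

  regroup regroup⁻¹ : Z4 → Z4
  regroup   (u , w , c , d) = u , d , w , c
  regroup⁻¹ (a , b , c , d) = a , c , d , b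

  regroup-⇿ : ∀ K κ → + K ≡ + 6 + + 8 * κ → Mixed K ∩ (Odd ∘ proj₁) ⇿ Sol (OddRep 1 9 1 K) DoubledMixedPair
  regroup-⇿ K κ K≡6+8κ = inverses⇒⇿ regroup regroup⁻¹ forth back (λ _ → refl) (λ _ → refl)
    where
    forth : Mixed K ∩ (Odd ∘ proj₁) ⊆ Sol (OddRep 1 9 1 K) DoubledMixedPair ∘ regroup
    forth {u , w , c , d} (((eq , u+w-odd) , c+d-odd) , u-odd)
      with w-even ← odd-sum∧odd⇒even u w u+w-odd u-odd
      with c-even , d-odd ← form₁₁₃≡6-mod-8⇒even-odd u w c d κ (trans eq K≡6+8κ) u-odd w-even c+d-odd =
      (trans (form₁₉₁-regroup u w c d) eq , u-odd , d-odd) ,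
      form₁₁₃≡6-mod-8⇒DoubledMixedPair u w c d κ (trans eq K≡6+8κ) u-odd w-even c-even d-odd
    back : Sol (OddRep 1 9 1 K) DoubledMixedPair ⊆ (Mixed K ∩ (Odd ∘ proj₁)) ∘ regroup⁻¹
    back {a , b , _ , _} ((eq , a-odd , b-odd) , p , q , refl , refl , _) =
      ((trans (sym (form₁₉₁-regroup a (+ 2 * p) (+ 2 * q) b)) eq , +-odd-even a-odd (twice-even p)) ,
       +-even-odd (twice-even q) b-odd) , a-odd

  permute-⇿ : ∀ K → Sol (OddRep 1 9 1 K) OddPair ⇿ Sol (OddRep 1 1 3 K) OddPair
  permute-⇿ K = inverses⇒⇿ regroup⁻¹ regroup
    (λ { {a , b , c , d} ((eq , a-odd , b-odd) , c-odd , d-odd) →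
         (trans (sym (form₁₉₁-regroup a c d b)) eq , a-odd , c-odd) , d-odd , b-odd })
    (λ { {a , b , c , d} ((eq , a-odd , b-odd) , c-odd , d-odd) →
         (trans (form₁₉₁-regroup a b c d) eq , a-odd , d-odd) , b-odd , c-odd })
    (λ _ → refl) (λ _ → refl)

  module Counts (n k : ℕ) (n≡1+4k : n ≡ 1 ℕ.+ k ℕ.* 4) where

    m B : ℕ
    m = 2 ℕ.* n ℕ.+ 4
    B = 4 ℕ.* m

    m≡6+8k : + m ≡ + 6 + + 8 * + k
    m≡6+8k = begin
      + (2 ℕ.* n ℕ.+ 4)                ≡⟨ cong (λ n → + (2 ℕ.* n ℕ.+ 4)) n≡1+4k ⟩
      + (2 ℕ.* (1 ℕ.+ k ℕ.* 4) ℕ.+ 4)  ≡⟨ cong +_ (ℕ-Solver.solve (k ∷ [])) ⟩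
      + (6 ℕ.+ 8 ℕ.* k)                ≡⟨ ℤₚ.pos-+ 6 (8 ℕ.* k) ⟩
      + 6 + + (8 ℕ.* k)                ≡⟨ cong (_+_ (+ 6)) (ℤₚ.pos-* 8 k) ⟩
      + 6 + + 8 * + k                  ∎

    m≤B : m ℕ.≤ B
    m≤B = ℕₚ.m≤n*m m 4

    Mixed-bounded : Bounded B (Mixed m)
    Mixed-bounded = Sol-bounded (MixedRep 1 1 3 m) (MixedRep-bounded 1 1 3 m≤B) MixedPair

    X : ℕ
    X = count B (sol? (rep? 2 2 3 m) doubledMixedPair?)

    N≡3X : N 2 2 3 9 m ≡ 3 ℕ.* X
    N≡3X = begin
      N 2 2 3 9 m
        ≡⟨ N≡count m ⟩
      count (m ℕ.+ 1) (sqRep? m)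
        ≡⟨ count-⇿ _ _ (SqRep-bounded m) (Sol-bounded (Rep 2 2 3 m) (Rep-bounded 2 2 3 m≤B) U) (sq-⇿ m) ⟩
      count B (sol? (rep? 2 2 3 m) U?)
        ≡⟨ count-⊎ B _ (sol? (rep? 2 2 3 m) (odd? ×? odd?)) _ classify (λ { (_ , _ , _ , _) (eq , _) → eq , _ })
                   (λ { (_ , _ , _ , _) (eq , _) → eq , _ }) disjoint ⟩
      count B (sol? (rep? 2 2 3 m) (odd? ×? odd?)) ℕ.+ X
        ≡⟨ cong (ℕ._+ X) (Rotation.count-OddPair≡2*count-DoubledMixedPair (Rep 2 2 3 m) (rep? 2 2 3 m) (Rep-bounded 2 2 3 m≤B)) ⟩
      2 ℕ.* X ℕ.+ X
        ≡⟨ arith X ⟩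
      3 ℕ.* X ∎
      where
      classify : ∀ z → Sol (Rep 2 2 3 m) U z → Sol (Rep 2 2 3 m) OddPair z ⊎ Sol (Rep 2 2 3 m) DoubledMixedPair z
      classify (a , b , c , d) (eq , _) =
        Sum.map (eq ,_) (eq ,_) (form₂₂₃≡6-mod-8⇒OddPair⊎DoubledMixedPair a b c d (+ k) (trans eq m≡6+8k))
      disjoint : ∀ z → Sol (Rep 2 2 3 m) OddPair z → ¬ Sol (Rep 2 2 3 m) DoubledMixedPair z
      disjoint (a , b , c , d) (_ , c-odd , _) (_ , p , _ , c≡2p , _) = even⇒¬odd (p , c≡2p) c-odd
      arith : ∀ x → 2 ℕ.* x ℕ.+ x ≡ 3 ℕ.* x
      arith = ℕ-Solver.solve-∀

    count-OddRep₁₉₁-DoubledMixedPair : count B (sol? (oddRep? 1 9 1 m) doubledMixedPair?) ≡ X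
    count-OddRep₁₉₁-DoubledMixedPair = ℕₚ.*-cancelˡ-≡ _ _ 2 (begin
      2 ℕ.* count B (sol? (oddRep? 1 9 1 m) doubledMixedPair?)
        ≡⟨ Rotation.count-OddPair≡2*count-DoubledMixedPair (OddRep 1 9 1 m) (oddRep? 1 9 1 m) (OddRep-bounded 1 9 1 m≤B) ⟨
      count B (sol? (oddRep? 1 9 1 m) (odd? ×? odd?))
        ≡⟨ count-⇿ _ _ (Sol-bounded (OddRep 1 9 1 m) (OddRep-bounded 1 9 1 m≤B) OddPair)
                       (Sol-bounded (OddRep 1 1 3 m) (OddRep-bounded 1 1 3 m≤B) OddPair) (permute-⇿ m) ⟩
      count B (sol? (oddRep? 1 1 3 m) (odd? ×? odd?))
        ≡⟨ Rotation.count-OddPair≡2*count-DoubledMixedPair (OddRep 1 1 3 m) (oddRep? 1 1 3 m) (OddRep-bounded 1 1 3 m≤B) ⟩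
      2 ℕ.* count B (sol? (oddRep? 1 1 3 m) doubledMixedPair?)
        ≡⟨ cong (2 ℕ.*_) (count-⇿ _ _ (Sol-bounded (Rep 2 2 3 m) (Rep-bounded 2 2 3 m≤B) DoubledMixedPair)
                                       (Sol-bounded (OddRep 1 1 3 m) (OddRep-bounded 1 1 3 m≤B) DoubledMixedPair)
                                       (sum-diff-⇿ m (+ k) m≡6+8k)) ⟨
      2 ℕ.* X ∎)

    count-Mixed : count B (mixed? m) ≡ 2 ℕ.* X
    count-Mixed = begin
      count B (mixed? m)
        ≡⟨ count-⊎ B _ (mixed? m ∩? (odd? ∘ proj₁)) (mixed? m ∩? (even? ∘ proj₁))
                   split (λ _ → proj₁) (λ _ → proj₁) disjoint ⟩
      count B (mixed? m ∩? (odd? ∘ proj₁)) ℕ.+ count B (mixed? m ∩? (even? ∘ proj₁))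
        ≡⟨ cong (count B (mixed? m ∩? (odd? ∘ proj₁)) ℕ.+_)
                (count-⇿ _ _ (λ z → Mixed-bounded z ∘ proj₁) (λ z → Mixed-bounded z ∘ proj₁) (swap-⇿ m)) ⟨
      count B (mixed? m ∩? (odd? ∘ proj₁)) ℕ.+ count B (mixed? m ∩? (odd? ∘ proj₁))
        ≡⟨ cong (λ x → x ℕ.+ x) (trans (count-⇿ _ _ (λ z → Mixed-bounded z ∘ proj₁)
                                                    (Sol-bounded (OddRep 1 9 1 m) (OddRep-bounded 1 9 1 m≤B) DoubledMixedPair)
                                                    (regroup-⇿ m (+ k) m≡6+8k))
                                         count-OddRep₁₉₁-DoubledMixedPair) ⟩
      X ℕ.+ X
        ≡⟨ cong (X ℕ.+_) (ℕₚ.+-identityʳ X) ⟨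
      2 ℕ.* X ∎
      where
      split : ∀ z → Mixed m z → (Mixed m ∩ (Odd ∘ proj₁)) z ⊎ (Mixed m ∩ (Even ∘ proj₁)) z
      split (u , _) sol = Sum.map (sol ,_) (sol ,_) (Sum.swap (even-or-odd u))
      disjoint : ∀ z → (Mixed m ∩ (Odd ∘ proj₁)) z → ¬ (Mixed m ∩ (Even ∘ proj₁)) z
      disjoint _ (_ , u-odd) (_ , u-even) = even⇒¬odd u-even u-odd

    t≡4X : t 2 2 3 9 n ≡ 4 ℕ.* X
    t≡4X = begin
      t 2 2 3 9 n
        ≡⟨ t≡count n ⟩
      count (n ℕ.+ 1) (triRep? n)
        ≡⟨ count-⇿ _ _ (TriRep-bounded n) (Sol-bounded (OddRep 2 2 3 B) (OddRep-bounded 2 2 3 ℕₚ.≤-refl) OddPair) (tri-⇿ n) ⟩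
      count B (sol? (oddRep? 2 2 3 B) (odd? ×? odd?))
        ≡⟨ Rotation.count-OddPair≡2*count-DoubledMixedPair (OddRep 2 2 3 B) (oddRep? 2 2 3 B) (OddRep-bounded 2 2 3 ℕₚ.≤-refl) ⟩
      2 ℕ.* count B (sol? (oddRep? 2 2 3 B) doubledMixedPair?)
        ≡⟨ cong (2 ℕ.*_) (count-⇿ _ _ Mixed-bounded
                                       (Sol-bounded (OddRep 2 2 3 B) (OddRep-bounded 2 2 3 ℕₚ.≤-refl) DoubledMixedPair)
                                       (sum-diff-doubled-⇿ m)) ⟨
      2 ℕ.* count B (mixed? m)
        ≡⟨ cong (2 ℕ.*_) count-Mixed ⟩
      2 ℕ.* (2 ℕ.* X)
        ≡⟨ ℕₚ.*-assoc 2 2 X ⟨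
      4 ℕ.* X ∎

    3t≡4N : 3 ℕ.* t 2 2 3 9 n ≡ 4 ℕ.* N 2 2 3 9 m
    3t≡4N = begin
      3 ℕ.* t 2 2 3 9 n  ≡⟨ cong (3 ℕ.*_) t≡4X ⟩
      3 ℕ.* (4 ℕ.* X)    ≡⟨ ℕₚ.*-assoc 3 4 X ⟨
      12 ℕ.* X           ≡⟨ ℕₚ.*-assoc 4 3 X ⟩
      4 ℕ.* (3 ℕ.* X)    ≡⟨ cong (4 ℕ.*_) N≡3X ⟨
      4 ℕ.* N 2 2 3 9 m  ∎

open import Data.Nat using (ℕ; _+_; _*_; _%_; _≥_)
open import Data.Nat.DivMod using (_/_; m≡m%n+[m/n]*n)
open import Relation.Binary.PropositionalEquality using (_≡_; trans; cong)

-- The hypothesis n ≥ 1 is implied by n % 4 ≡ 1.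
theorem2p12 : (n : ℕ) → n ≥ 1 → n % 4 ≡ 1 → 3 * t 2 2 3 9 n ≡ 4 * N 2 2 3 9 (2 * n + 4)
theorem2p12 n _ n%4≡1 = Counts.3t≡4N n (n / 4) (trans (m≡m%n+[m/n]*n n 4) (cong (_+ n / 4 * 4) n%4≡1))
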